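{- Let $G$ be a finite connected graph with shortest-path metric $d$ and four-points hyperbolicity constant $\hat\delta$. Then $$\hat\delta\le\max_{u_1,u_2,u_3,u_4\in V(G)}\ \min_{i\neq j}d(u_i,u_j).$$
   Context: The four-points hyperbolicity constant of $G$ is the least $\hat\delta\ge0$ such that for all vertices $a,b,c,d$: $d(a,b)+d(c,d)\le\max\{d(a,c)+d(b,d),\ d(a,d)+d(b,c)\}+2\hat\delta$. -}

module Defs where

open import Data.Nat using (ℕ; zero; suc; _+_; _*_; _≤_; _⊔_; _⊓_)
open import Data.Fin using (Fin)
open import Data.Product using (Σ; ∃; _×_; _,_)
open import Relation.Binary.PropositionalEquality using (_≡_; _≢_)
open import Relation.Nullary using (¬_)
open import Level using (0ℓ)

record Graph (n : ℕ) : Set₁ where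
  field
    Adj      : Fin n → Fin n → Set
    sym      : ∀ {u v} → Adj u v → Adj v u
    irrefl   : ∀ {u} → ¬ Adj u u

open Graph public

data Walk {n : ℕ} (G : Graph n) : Fin n → Fin n → ℕ → Set where
  [] : ∀ {u} → Walk G u u zero
  _∷_ : ∀ {u v w k} → Adj G u v → Walk G v w k → Walk G u w (suc k)

Connected : ∀ {n} → Graph n → Set
Connected G = ∀ u v → ∃ λ k → Walk G u v k

IsShortestPathMetric : ∀ {n} → Graph n → (Fin n → Fin n → ℕ) → Set
IsShortestPathMetric G d =
  ∀ u v → Walk G u v (d u v) × (∀ k → Walk G u v k → d u v ≤ k)

-- Four-point condition with slack h = 2δ:
-- d(a,b)+d(c,d) ≤ max{d(a,c)+d(b,d), d(a,d)+d(b,c)} + h for all a b c e.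
FourPoint : ∀ {n} → (Fin n → Fin n → ℕ) → ℕ → Set
FourPoint d h = ∀ a b c e →
  d a b + d c e ≤ ((d a c + d b e) ⊔ (d a e + d b c)) + h

IsTwiceFourPointConst : ∀ {n} → (Fin n → Fin n → ℕ) → ℕ → Set
IsTwiceFourPointConst d h = FourPoint d h × (∀ h' → FourPoint d h' → h ≤ h')

minPair : ∀ {n} → (Fin n → Fin n → ℕ) → Fin n → Fin n → Fin n → Fin n → ℕ
minPair d u₁ u₂ u₃ u₄ =
  d u₁ u₂ ⊓ d u₁ u₃ ⊓ d u₁ u₄ ⊓ d u₂ u₃ ⊓ d u₂ u₄ ⊓ d u₃ u₄

IsMaxMinPair : ∀ {n} → (Fin n → Fin n → ℕ) → ℕ → Set
IsMaxMinPair d M =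
  (∃ λ u₁ → ∃ λ u₂ → ∃ λ u₃ → ∃ λ u₄ → minPair d u₁ u₂ u₃ u₄ ≡ M) ×
  (∀ u₁ u₂ u₃ u₄ → minPair d u₁ u₂ u₃ u₄ ≤ M)

-- Fix a b c e and write S₁ = d(a,b)+d(c,e), S₂ = d(a,c)+d(b,e),
-- S₃ = d(a,e)+d(b,c).  For each of the six pairs {x,y} ⊆ {a,b,c,e}, the
-- triangle inequality alone gives  S₁ ≤ S₂ + 2d(x,y)  or  S₁ ≤ S₃ + 2d(x,y):
-- route the two long distances of S₁ through the pair {x,y}.  Hence
-- S₁ ≤ max(S₂,S₃) + 2·min_{x≠y} d(x,y) ≤ max(S₂,S₃) + 2M, i.e. 2M satisfies
-- the four-point condition, and minimality of 2δ̂ gives 2δ̂ ≤ 2M.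
module Submission where

open import Defs hiding (sym)
open import Data.Nat using (ℕ; suc; _+_; _*_; _≤_; _⊔_; _⊓_)
open import Data.Nat.Properties
open import Data.Fin using (Fin)
open import Data.Product using (_,_; proj₁; proj₂)
open import Relation.Binary.PropositionalEquality
open import Data.Nat.Solver using (module +-*-Solver)
open +-*-Solver using (solve; _:+_; _:*_; _:=_; con)

module Walks {n : ℕ} (G : Graph n) where

  _++ᵂ_ : ∀ {u v w k l} → Walk G u v k → Walk G v w l → Walk G u w (k + l)
  [] ++ᵂ q = q
  (e ∷ p) ++ᵂ q = e ∷ (p ++ᵂ q)

  reverse : ∀ {u v k} → Walk G u v k → Walk G v u k
  reverse [] = []
  reverse {k = suc k} (e ∷ p) =
    subst (Walk G _ _) (+-comm k 1) (reverse p ++ᵂ (Graph.sym G e ∷ []))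

module ShortestPath {n : ℕ} (G : Graph n) (d : Fin n → Fin n → ℕ)
                    (sp : IsShortestPathMetric G d) where
  open Walks G

  shortest : ∀ u v → Walk G u v (d u v)
  shortest u v = proj₁ (sp u v)

  minimal : ∀ {u v k} → Walk G u v k → d u v ≤ k
  minimal {u} {v} = proj₂ (sp u v) _

  d-sym : ∀ u v → d u v ≡ d v u
  d-sym u v = ≤-antisym (minimal (reverse (shortest v u)))
                        (minimal (reverse (shortest u v)))

  triangle : ∀ u v w → d u w ≤ d u v + d v w
  triangle u v w = minimal (shortest u v ++ᵂ shortest v w)

module FourPointEstimates {V : Set} (d : V → V → ℕ)
                          (d-sym : ∀ u v → d u v ≡ d v u)
                          (triangle : ∀ u v w → d u w ≤ d u v + d v w) where

  pairing : V → V → V → V → ℕ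
  pairing p q r s = d p q + d r s

  throughPair : ∀ p q r s → pairing p q r s ≤ 2 * d p q + pairing p r q s
  throughPair p q r s = begin
    d p q + d r s                      ≤⟨ +-monoʳ-≤ (d p q) detour ⟩
    d p q + (d p r + (d p q + d q s))  ≡⟨ rearrange (d p q) (d p r) (d q s) ⟩
    2 * d p q + (d p r + d q s)        ∎
    where
    open ≤-Reasoning
    detour : d r s ≤ d p r + (d p q + d q s)
    detour = begin
      d r s                  ≤⟨ triangle r p s ⟩
      d r p + d p s          ≤⟨ +-mono-≤ (≤-reflexive (d-sym r p)) (triangle p q s) ⟩
      d p r + (d p q + d q s) ∎
    rearrange : ∀ x y z → x + (y + (x + z)) ≡ 2 * x + (y + z)
    rearrange = solve 3 (λ x y z → x :+ (y :+ (x :+ z)) := con 2 :* x :+ (y :+ z)) refl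

  acrossPair : ∀ p q r s → pairing p q r s ≤ 2 * d p r + pairing p s q r
  acrossPair p q r s = begin
    d p q + d r s                      ≤⟨ +-mono-≤ viaR viaP ⟩
    (d p r + d q r) + (d p r + d p s)  ≡⟨ rearrange (d p r) (d q r) (d p s) ⟩
    2 * d p r + (d p s + d q r)        ∎
    where
    open ≤-Reasoning
    viaR : d p q ≤ d p r + d q r
    viaR = ≤-trans (triangle p r q) (+-monoʳ-≤ (d p r) (≤-reflexive (d-sym r q)))
    viaP : d r s ≤ d p r + d p s
    viaP = ≤-trans (triangle r p s) (+-monoˡ-≤ (d p s) (≤-reflexive (d-sym r p)))
    rearrange : ∀ x y z → (x + y) + (x + z) ≡ 2 * x + (z + y)
    rearrange = solve 3 (λ x y z → (x :+ y) :+ (x :+ z) := con 2 :* x :+ (z :+ y)) refl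

  Bounded : V → V → V → V → ℕ → Set
  Bounded a b c e m =
    pairing a b c e ≤ (pairing a c b e ⊔ pairing a e b c) + 2 * m

  viaSecond : ∀ {a b c e} m → pairing a b c e ≤ 2 * m + pairing a c b e →
              Bounded a b c e m
  viaSecond {a} {b} {c} {e} m le =
    ≤-trans le (≤-trans (+-monoʳ-≤ (2 * m) (m≤m⊔n (pairing a c b e) (pairing a e b c)))
                        (≤-reflexive (+-comm (2 * m) _)))

  viaThird : ∀ {a b c e} m → pairing a b c e ≤ 2 * m + pairing a e b c →
             Bounded a b c e m
  viaThird {a} {b} {c} {e} m le =
    ≤-trans le (≤-trans (+-monoʳ-≤ (2 * m) (m≤n⊔m (pairing a c b e) (pairing a e b c)))
                        (≤-reflexive (+-comm (2 * m) _)))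

  flipFirst : ∀ p q r s → pairing p q r s ≡ pairing q p r s
  flipFirst p q r s = cong (_+ d r s) (d-sym p q)

  flipSecond : ∀ p q r s → pairing p q r s ≡ pairing p q s r
  flipSecond p q r s = cong (d p q +_) (d-sym r s)

  exchange : ∀ p q r s → pairing p q r s ≡ pairing r s p q
  exchange p q r s = +-comm (d p q) (d r s)

  reshape : ∀ {x x′ y y′} m → x ≡ x′ → y ≡ y′ → x ≤ 2 * m + y → x′ ≤ 2 * m + y′
  reshape m = subst₂ (λ x y → x ≤ 2 * m + y)

  bounded-ab : ∀ a b c e → Bounded a b c e (d a b)
  bounded-ab a b c e = viaSecond (d a b) (throughPair a b c e)

  bounded-ce : ∀ a b c e → Bounded a b c e (d c e)
  bounded-ce a b c e = viaSecond (d c e)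
    (reshape (d c e) (exchange c e a b)
                     (trans (flipFirst c a e b) (flipSecond a c e b))
                     (throughPair c e a b))

  bounded-ac : ∀ a b c e → Bounded a b c e (d a c)
  bounded-ac a b c e = viaThird (d a c) (acrossPair a b c e)

  bounded-ae : ∀ a b c e → Bounded a b c e (d a e)
  bounded-ae a b c e = viaSecond (d a e)
    (reshape (d a e) (flipSecond a b e c) refl (acrossPair a b e c))

  bounded-bc : ∀ a b c e → Bounded a b c e (d b c)
  bounded-bc a b c e = viaSecond (d b c)
    (reshape (d b c) (flipFirst b a c e) (exchange b e a c) (acrossPair b a c e))

  bounded-be : ∀ a b c e → Bounded a b c e (d b e)
  bounded-be a b c e = viaThird (d b e)
    (reshape (d b e) (trans (flipFirst b a e c) (flipSecond a b e c))
                     (exchange b c a e)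
                     (acrossPair b a e c))

  bounded-⊓ : ∀ {a b c e} x y → Bounded a b c e x → Bounded a b c e y →
              Bounded a b c e (x ⊓ y)
  bounded-⊓ {a} {b} {c} {e} x y bx by = begin
    pairing a b c e                  ≤⟨ ⊓-glb bx by ⟩
    (X + 2 * x) ⊓ (X + 2 * y)        ≡⟨ sym (+-distribˡ-⊓ X (2 * x) (2 * y)) ⟩
    X + ((2 * x) ⊓ (2 * y))          ≡⟨ cong (X +_) (sym (*-distribˡ-⊓ 2 x y)) ⟩
    X + 2 * (x ⊓ y)                  ∎
    where
    open ≤-Reasoning
    X : ℕ
    X = pairing a c b e ⊔ pairing a e b c

fourPointMinPair : ∀ {n} (d : Fin n → Fin n → ℕ) →
  (∀ u v → d u v ≡ d v u) → (∀ u v w → d u w ≤ d u v + d v w) →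
  ∀ a b c e → d a b + d c e ≤ ((d a c + d b e) ⊔ (d a e + d b c)) + 2 * minPair d a b c e
fourPointMinPair d d-sym triangle a b c e =
  bounded-⊓ (d a b ⊓ d a c ⊓ d a e ⊓ d b c ⊓ d b e) (d c e)
    (bounded-⊓ (d a b ⊓ d a c ⊓ d a e ⊓ d b c) (d b e)
      (bounded-⊓ (d a b ⊓ d a c ⊓ d a e) (d b c)
        (bounded-⊓ (d a b ⊓ d a c) (d a e)
          (bounded-⊓ (d a b) (d a c) (bounded-ab a b c e) (bounded-ac a b c e))
          (bounded-ae a b c e))
        (bounded-bc a b c e))
      (bounded-be a b c e))
    (bounded-ce a b c e)
  where open FourPointEstimates d d-sym triangle

mainTheorem7 : (n : ℕ) (G : Graph (suc n)) → Connected G →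
    (d : Fin (suc n) → Fin (suc n) → ℕ) → IsShortestPathMetric G d →
    (h : ℕ) → IsTwiceFourPointConst d h →
    (M : ℕ) → IsMaxMinPair d M →
    h ≤ 2 * M
mainTheorem7 n G _ d sp h (_ , least) M (_ , maxIsUpper) = least (2 * M) slack2M
  where
  open ShortestPath G d sp using (d-sym; triangle)
  slack2M : FourPoint d (2 * M)
  slack2M a b c e = ≤-trans (fourPointMinPair d d-sym triangle a b c e)
    (+-monoʳ-≤ ((d a c + d b e) ⊔ (d a e + d b c)) (*-monoʳ-≤ 2 (maxIsUpper a b c e)))
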